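{- Let $G$ be a finite simple graph, let $s \geq 3$ be an integer, let $u \in V(G)$ satisfy $c(u) = \max\{c(v) \mid v \in V(G)\}$, and let $P$ be a longest $u$-path in $G$. Let $v \in L(G,P,u)$ with $d(v) \geq |S_v| \geq 1$, where $S_v = N(v)\setminus L(G,P,u)$. Then \[ \frac{1}{d(v) - |S_v| + 1} \left( \binom{d(v) + 1}{s} - \binom{|S_v|}{s} \right) \leq \frac{1}{|S_v| + d(v) - 1} \binom{|S_v| + d(v)}{s}. \]
   Context: $d(v)$ is the degree and $N(v)$ the neighbourhood of $v$. Binomial coefficients $\binom{a}{b}$ are $0$ when $a<b$. For $v\in V(G)$, $c(v)$ is the length of the longest cycle containing $v$, or $2$ if $v$ is on no cycle. A $u$-path is a path starting at $u$; its other end is its terminal vertex; a longest $u$-path is one of maximum length among $u$-paths. If $Q = v_0v_1\dots v_k$ ($v_0=u$) is a longest $u$-path and $v_k$ is adjacent to $v_j$ for some $0 \le j \le k-2$, the path $v_0\dots v_jv_kv_{k-1}\dots v_{j+1}$ is a simple transform of $Q$. A transform of $P$ is any path obtained from $P$ by a finite sequence of simple transforms. $L(G,P,u)$ is the set of terminal vertices of transforms of $P$. -}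

module Defs where

open import Data.Nat.Base using (ℕ; zero; suc; _≤_)
open import Data.Bool.Base using (Bool; true; false)
open import Data.Fin.Base using (Fin)
open import Data.List.Base using (List; []; _∷_; _++_; _∷ʳ_; reverse; length)
open import Data.List.Relation.Unary.Unique.Propositional using (Unique)
open import Data.List.Relation.Unary.Linked using (Linked)
open import Data.List.Membership.Propositional using () renaming (_∈_ to _∈ˡ_)
open import Data.Vec.Base using (tabulate)
open import Data.Fin.Subset using (Subset)
open import Data.Product.Base using (Σ; ∃; _×_)
open import Data.Sum.Base using (_⊎_)
open import Data.Integer.Base using (ℤ)
open import Relation.Nullary using (¬_)
open import Relation.Binary.PropositionalEquality using (_≡_)
open import Relation.Binary.Construct.Closure.ReflexiveTransitive using (Star)
import Data.Rational.Base as ℚ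

record Graph (n : ℕ) : Set where
  field
    adj    : Fin n → Fin n → Bool
    sym    : ∀ x y → adj x y ≡ adj y x
    irrefl : ∀ x → adj x x ≡ false
open Graph public

module _ {n : ℕ} (G : Graph n) where

  E : Fin n → Fin n → Set
  E x y = adj G x y ≡ true

  N : Fin n → Subset n
  N v = tabulate (adj G v)

  IsPath : List (Fin n) → Set
  IsPath Q = Unique Q × Linked E Q

  -- A u-path: a path whose first vertex is u.  Its length is the number
  -- of edges, i.e. length rest for Q = u ∷ rest.
  IsUPath : Fin n → List (Fin n) → Set
  IsUPath u Q = Σ (List (Fin n)) λ rest → Q ≡ u ∷ rest × IsPath Q

  edgeLength : List (Fin n) → ℕ
  edgeLength []      = 0
  edgeLength (_ ∷ r) = length r

  IsLongestUPath : Fin n → List (Fin n) → Set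
  IsLongestUPath u Q =
    IsUPath u Q × (∀ Q' → IsUPath u Q' → edgeLength Q' ≤ edgeLength Q)

  CycleThrough : Fin n → ℕ → Set
  CycleThrough v m = Σ (Fin n) λ c → Σ (List (Fin n)) λ cs →
    Unique (c ∷ cs) × Linked E ((c ∷ cs) ∷ʳ c) ×
    length (c ∷ cs) ≡ m × 3 ≤ m × v ∈ˡ (c ∷ cs)

  IsC : Fin n → ℕ → Set
  IsC v m = (CycleThrough v m × (∀ m' → CycleThrough v m' → m' ≤ m))
          ⊎ (m ≡ 2 × (∀ m' → ¬ CycleThrough v m'))

  -- Simple transform of a longest u-path Q = xs ++ [v_j] ++ ys ++ [v_k]
  -- (ys nonempty, i.e. j ≤ k-2) with v_k adjacent to v_j:
  -- result xs ++ [v_j] ++ reverse (ys ++ [v_k]).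
  data SimpleTransform (u : Fin n) : List (Fin n) → List (Fin n) → Set where
    simple : ∀ xs x y₀ ys y →
      IsLongestUPath u (xs ++ x ∷ (y₀ ∷ ys) ∷ʳ y) →
      E y x →
      SimpleTransform u (xs ++ x ∷ (y₀ ∷ ys) ∷ʳ y)
                        (xs ++ x ∷ reverse ((y₀ ∷ ys) ∷ʳ y))

  Transform : Fin n → List (Fin n) → List (Fin n) → Set
  Transform u = Star (SimpleTransform u)

  InL : List (Fin n) → Fin n → Fin n → Set
  InL P u v = Σ (List (Fin n)) λ ys → Transform u P (ys ∷ʳ v)

-- Division of an integer by a natural number as a rational
-- (only used with positive denominators; value 0 for denominator 0).
_÷ℕ_ : ℤ → ℕ → ℚ.ℚ
x ÷ℕ zero  = ℚ.0ℚ
x ÷ℕ suc d = x ℚ./ suc d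

{-# OPTIONS --safe #-}
-- By the hockey-stick identity the left side is the average of
-- g j = C(j, s-1) over k ≤ j ≤ d, while the right side is at least its
-- average over 1 ≤ j ≤ k+d-1.  The two intervals have the same centre, and
-- for convex g the average over concentric intervals grows with the width:
-- pairing each term with its mirror image shows that the two values added
-- just outside an interval have a mean at least the interval's average.
module Submission where

open import Defs using (Graph; N; IsC; IsLongestUPath; InL; _÷ℕ_)
open import Data.Nat.Base
  using (ℕ; zero; suc; _+_; _*_; _∸_; _≤_; _≥_; z≤n; s≤s; NonZero; _≤′_; ≤′-refl; ≤′-step)
open import Data.Nat.Properties
open import Data.Nat.Combinatorics using (_C_; nCk+nC[k+1]≡[n+1]C[k+1])
open import Data.Nat.Tactic.RingSolver using (solve-∀)
open import Data.Integer.Base using (+_; _⊖_) renaming (_-_ to _-ℤ_)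
import Data.Integer.Base as ℤ
import Data.Integer.Properties as ℤ
open import Data.Fin.Base using (Fin)
open import Data.Fin.Subset using (Subset; ∣_∣; _─_) renaming (_∈_ to _∈ₛ_)
open import Data.List.Base using (List)
open import Data.Product.Base using (Σ; _×_; _,_)
open import Function.Bundles using (_⇔_)
open import Relation.Binary.PropositionalEquality
  using (_≡_; refl; sym; trans; cong; cong₂; subst; subst₂; module ≡-Reasoning)
import Data.Rational.Base as ℚ
import Data.Rational.Properties as ℚ
import Data.Rational.Unnormalised.Base as ℚᵘ
import Data.Rational.Unnormalised.Properties as ℚᵘ

intervalSum : (ℕ → ℕ) → ℕ → ℕ → ℕ
intervalSum g a zero    = 0
intervalSum g a (suc m) = g a + intervalSum g (suc a) m

intervalSum-snoc : ∀ g a m → intervalSum g a (suc m) ≡ intervalSum g a m + g (a + m)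
intervalSum-snoc g a zero    = trans (+-identityʳ (g a)) (cong g (sym (+-identityʳ a)))
intervalSum-snoc g a (suc m) = begin
  g a + intervalSum g (suc a) (suc m)                   ≡⟨ cong (λ T → g a + T) (intervalSum-snoc g (suc a) m) ⟩
  g a + (intervalSum g (suc a) m + g (suc (a + m)))     ≡⟨ +-assoc (g a) _ _ ⟨
  g a + intervalSum g (suc a) m + g (suc (a + m))       ≡⟨ cong (λ i → g a + intervalSum g (suc a) m + g i) (+-suc a m) ⟨
  g a + intervalSum g (suc a) m + g (a + suc m)         ∎
  where open ≡-Reasoning

C-pascal : ∀ n k → suc n C suc k ≡ n C k + n C suc k
C-pascal n k = sym (nCk+nC[k+1]≡[n+1]C[k+1] n k)

C-suc-≤ : ∀ n k → n C k ≤ suc n C k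
C-suc-≤ n zero    = ≤-refl
C-suc-≤ n (suc k) = subst (n C suc k ≤_) (sym (C-pascal n k)) (m≤n+m _ _)

C-monoˡ-≤ : ∀ k {m n} → m ≤ n → m C k ≤ n C k
C-monoˡ-≤ k m≤n = mono (≤⇒≤′ m≤n)
  where
  mono : ∀ {m n} → m ≤′ n → m C k ≤ n C k
  mono ≤′-refl        = ≤-refl
  mono (≤′-step m≤′n) = ≤-trans (mono m≤′n) (C-suc-≤ _ k)

intervalSum-hockey-stick : ∀ t a m → a C suc t + intervalSum (_C t) a m ≡ (a + m) C suc t
intervalSum-hockey-stick t a zero    = trans (+-identityʳ _) (cong (_C suc t) (sym (+-identityʳ a)))
intervalSum-hockey-stick t a (suc m) = begin
  a C suc t + (a C t + intervalSum (_C t) (suc a) m)   ≡⟨ +-assoc (a C suc t) _ _ ⟨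
  a C suc t + a C t + intervalSum (_C t) (suc a) m     ≡⟨ cong (_+ intervalSum (_C t) (suc a) m) pascal ⟩
  suc a C suc t + intervalSum (_C t) (suc a) m         ≡⟨ intervalSum-hockey-stick t (suc a) m ⟩
  (suc a + m) C suc t                                  ≡⟨ cong (_C suc t) (+-suc a m) ⟨
  (a + suc m) C suc t                                  ∎
  where
  open ≡-Reasoning
  pascal : a C suc t + a C t ≡ suc a C suc t
  pascal = trans (+-comm (a C suc t) (a C t)) (sym (C-pascal a t))

Convex : (ℕ → ℕ) → Set
Convex g = ∀ {x y} → x ≤ y → g (suc x) + g (suc y) ≤ g x + g (suc (suc y))

C-convex : ∀ k → Convex (_C suc k)
C-convex k {x} {y} x≤y = begin
  suc x C suc k + suc y C suc k                  ≡⟨ cong (_+ suc y C suc k) (C-pascal x k) ⟩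
  x C k + x C suc k + suc y C suc k              ≡⟨ swap (x C k) (x C suc k) _ ⟩
  x C suc k + (x C k + suc y C suc k)            ≤⟨ +-monoʳ-≤ (x C suc k) (+-monoˡ-≤ _ (C-monoˡ-≤ k (m≤n⇒m≤1+n x≤y))) ⟩
  x C suc k + (suc y C k + suc y C suc k)        ≡⟨ cong (λ T → x C suc k + T) (C-pascal (suc y) k) ⟨
  x C suc k + suc (suc y) C suc k                ∎
  where
  open ≤-Reasoning
  swap : ∀ a b c → a + b + c ≡ b + (a + c)
  swap = solve-∀

-- Averages are compared cross-multiplied: A / m ≤ B / n is stated as A * n ≤ B * m.
ratio-≤-trans : ∀ {a b c d e f} .{{_ : NonZero d}} →
                a * d ≤ c * b → c * f ≤ e * d → a * f ≤ e * b
ratio-≤-trans {a} {b} {c} {d} {e} {f} ad≤cb cf≤ed = *-cancelˡ-≤ d (begin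
  d * (a * f)    ≡⟨ shuffle d a f ⟩
  a * d * f      ≤⟨ *-monoˡ-≤ f ad≤cb ⟩
  c * b * f      ≡⟨ shuffle b c f ⟨
  b * (c * f)    ≤⟨ *-monoʳ-≤ b cf≤ed ⟩
  b * (e * d)    ≡⟨ rotate b e d ⟩
  d * (e * b)    ∎)
  where
  open ≤-Reasoning
  shuffle : ∀ x y z → x * (y * z) ≡ y * x * z
  shuffle = solve-∀
  rotate : ∀ x y z → x * (y * z) ≡ z * (y * x)
  rotate = solve-∀

module _ {g : ℕ → ℕ} (convex : Convex g) where

  2*intervalSum≤outer : ∀ q m → 2 * intervalSum g (suc q) m ≤ m * (g q + g (suc q + m))
  2*intervalSum≤outer q zero          = z≤n
  2*intervalSum≤outer q (suc zero)    = begin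
    2 * (g (suc q) + 0)              ≡⟨ double (g (suc q)) ⟩
    g (suc q) + g (suc q)            ≤⟨ convex ≤-refl ⟩
    g q + g (suc (suc q))            ≡⟨ cong (λ i → g q + g i) (+-comm 1 (suc q)) ⟩
    g q + g (suc q + 1)              ≡⟨ *-identityˡ _ ⟨
    1 * (g q + g (suc q + 1))        ∎
    where
    open ≤-Reasoning
    double : ∀ a → 2 * (a + 0) ≡ a + a
    double = solve-∀
  2*intervalSum≤outer q (suc (suc m)) = begin
    2 * (g (suc q) + intervalSum g (suc (suc q)) (suc m))
      ≡⟨ cong (λ T → 2 * (g (suc q) + T)) (intervalSum-snoc g (suc (suc q)) m) ⟩
    2 * (g (suc q) + (S + g (suc (suc (q + m)))))
      ≡⟨ regroup (g (suc q)) S _ ⟩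
    2 * S + 2 * (g (suc q) + g (suc (suc (q + m))))
      ≤⟨ +-monoˡ-≤ _ (2*intervalSum≤outer (suc q) m) ⟩
    m * (g (suc q) + g (suc (suc (q + m)))) + 2 * (g (suc q) + g (suc (suc (q + m))))
      ≡⟨ collect m _ ⟩
    suc (suc m) * (g (suc q) + g (suc (suc (q + m))))
      ≤⟨ *-monoʳ-≤ (suc (suc m)) (convex (m≤n⇒m≤1+n (m≤m+n q m))) ⟩
    suc (suc m) * (g q + g (suc (suc (suc (q + m)))))
      ≡⟨ cong (λ i → suc (suc m) * (g q + g (suc i))) q+[2+m] ⟨
    suc (suc m) * (g q + g (suc q + suc (suc m)))
      ∎
    where
    open ≤-Reasoning
    S = intervalSum g (suc (suc q)) m
    regroup : ∀ a b c → 2 * (a + (b + c)) ≡ 2 * b + 2 * (a + c)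
    regroup = solve-∀
    collect : ∀ m a → m * a + 2 * a ≡ suc (suc m) * a
    collect = solve-∀
    q+[2+m] : q + suc (suc m) ≡ suc (suc (q + m))
    q+[2+m] = trans (+-suc q (suc m)) (cong suc (+-suc q m))

  intervalAverage-widen : ∀ q m → intervalSum g (suc q) m * (2 + m) ≤ intervalSum g q (2 + m) * m
  intervalAverage-widen q m = begin
    S * (2 + m)                              ≡⟨ split S m ⟩
    2 * S + S * m                            ≤⟨ +-monoˡ-≤ (S * m) (2*intervalSum≤outer q m) ⟩
    m * (g q + g (suc q + m)) + S * m        ≡⟨ merge m S (g q) _ ⟩
    (g q + (S + g (suc q + m))) * m          ≡⟨ cong (λ T → (g q + T) * m) (intervalSum-snoc g (suc q) m) ⟨
    intervalSum g q (2 + m) * m              ∎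
    where
    open ≤-Reasoning
    S = intervalSum g (suc q) m
    split : ∀ S m → S * (2 + m) ≡ 2 * S + S * m
    split = solve-∀
    merge : ∀ m S a b → m * (a + b) + S * m ≡ (a + (S + b)) * m
    merge = solve-∀

  intervalAverage-nested : ∀ p m → intervalSum g (suc p) m * (p + p + m) ≤ intervalSum g 1 (p + p + m) * m
  intervalAverage-nested zero    m = ≤-refl
  intervalAverage-nested (suc p) m =
    ratio-≤-trans {a = intervalSum g (suc (suc p)) m} {c = intervalSum g (suc p) (2 + m)} {d = 2 + m}
      {e = intervalSum g 1 (suc p + suc p + m)}
      (intervalAverage-widen (suc p) m)
      (subst (λ N → intervalSum g (suc p) (2 + m) * N ≤ intervalSum g 1 N * (2 + m))
             (width p m) (intervalAverage-nested p (2 + m)))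
    where
    width : ∀ p m → p + p + (2 + m) ≡ suc p + suc p + m
    width = solve-∀

[+m+n]-[+m]≡+n : ∀ m n → + (m + n) -ℤ + m ≡ + n
[+m+n]-[+m]≡+n m n = begin
  + (m + n) -ℤ + m     ≡⟨ ℤ.[+m]-[+n]≡m⊖n (m + n) m ⟩
  (m + n) ⊖ m          ≡⟨ cong ((m + n) ⊖_) (+-identityʳ m) ⟨
  (m + n) ⊖ (m + 0)    ≡⟨ ℤ.+-cancelˡ-⊖ m n 0 ⟩
  + n                  ∎
  where open ≡-Reasoning

cross-≤⇒÷ℕ-≤ : ∀ {a b c e} → a * suc e ≤ c * suc b → ((+ a) ÷ℕ suc b) ℚ.≤ ((+ c) ÷ℕ suc e)
-- (+ a) ÷ℕ suc b is, by definition, the normalisation fromℚᵘ (mkℚᵘ (+ a) b).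
cross-≤⇒÷ℕ-≤ {a} {b} {c} {e} ae≤cb = ℚ.toℚᵘ-cancel-≤
  (ℚᵘ.≤-respʳ-≃ (ℚᵘ.≃-sym (ℚ.toℚᵘ-fromℚᵘ (ℚᵘ.mkℚᵘ (+ c) e)))
  (ℚᵘ.≤-respˡ-≃ (ℚᵘ.≃-sym (ℚ.toℚᵘ-fromℚᵘ (ℚᵘ.mkℚᵘ (+ a) b)))
    (ℚᵘ.*≤* (subst₂ ℤ._≤_ (ℤ.pos-* a (suc e)) (ℤ.pos-* c (suc b)) (ℤ.+≤+ ae≤cb)))))

binomial-average-≤ : ∀ r {d k} → k ≤ d → 1 ≤ k → let s = 2 + r in
  ((+ ((d + 1) C s) -ℤ + (k C s)) ÷ℕ (d ∸ k + 1)) ℚ.≤ ((+ ((k + d) C s)) ÷ℕ (k + d ∸ 1))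
binomial-average-≤ r {k = suc p} k≤d (s≤s z≤n) with m≤n⇒∃[o]m+o≡n k≤d
... | m , refl = subst₂ ℚ._≤_
  (cong₂ _÷ℕ_ (sym numerator) (sym (m+n∸m≡n+1 (suc p) m)))
  (cong (λ n → (+ ((k + d) C s)) ÷ℕ n) (sym (k+d∸1 p m)))
  (cross-≤⇒÷ℕ-≤ {a = intervalSum g k (suc m)} {c = (k + d) C s} cross)
  where
  s = 2 + r
  k = suc p
  d = k + m
  g = _C suc r
  numerator : + ((d + 1) C s) -ℤ + (k C s) ≡ + intervalSum g k (suc m)
  numerator = begin
    + ((d + 1) C s) -ℤ + (k C s)
      ≡⟨ cong (λ i → + (i C s) -ℤ + (k C s)) (trans (+-comm d 1) (sym (+-suc k m))) ⟩
    + ((k + suc m) C s) -ℤ + (k C s)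
      ≡⟨ cong (λ i → + i -ℤ + (k C s)) (intervalSum-hockey-stick (suc r) k (suc m)) ⟨
    + (k C s + intervalSum g k (suc m)) -ℤ + (k C s)
      ≡⟨ [+m+n]-[+m]≡+n (k C s) _ ⟩
    + intervalSum g k (suc m)
      ∎
    where open ≡-Reasoning
  m+n∸m≡n+1 : ∀ a b → a + b ∸ a + 1 ≡ suc b
  m+n∸m≡n+1 a b = trans (cong (_+ 1) (m+n∸m≡n a b)) (+-comm b 1)
  k+d∸1 : ∀ p m → p + suc (p + m) ≡ suc (p + p + m)
  k+d∸1 = solve-∀
  cross : intervalSum g k (suc m) * suc (p + p + m) ≤ ((k + d) C s) * suc m
  cross = begin
    intervalSum g k (suc m) * suc (p + p + m)   ≡⟨ cong (intervalSum g k (suc m) *_) (+-suc (p + p) m) ⟨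
    intervalSum g k (suc m) * (p + p + suc m)   ≤⟨ intervalAverage-nested (C-convex r) p (suc m) ⟩
    intervalSum g 1 (p + p + suc m) * suc m     ≤⟨ *-monoˡ-≤ (suc m) (m≤n+m (intervalSum g 1 (p + p + suc m)) (1 C s)) ⟩
    (1 C s + intervalSum g 1 (p + p + suc m)) * suc m
      ≡⟨ cong (_* suc m) (intervalSum-hockey-stick (suc r) 1 (p + p + suc m)) ⟩
    (suc (p + p + suc m) C s) * suc m           ≡⟨ cong (λ i → (i C s) * suc m) (k+d p m) ⟩
    ((k + d) C s) * suc m                       ∎
    where
    open ≤-Reasoning
    k+d : ∀ p m → suc (p + p + suc m) ≡ suc p + (suc p + m)
    k+d = solve-∀

lemma2p31 : ∀ {n : ℕ} (G : Graph n) (s : ℕ) → s ≥ 3 →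
  (u : Fin n) →
  Σ ℕ (λ cu → IsC G u cu × (∀ v cv → IsC G v cv → cv ≤ cu)) →
  (P : List (Fin n)) → IsLongestUPath G u P →
  (Lset : Subset n) → (∀ w → (w ∈ₛ Lset) ⇔ InL G P u w) →
  (v : Fin n) → InL G P u v →
  let d = ∣ N G v ∣
      k = ∣ N G v ─ Lset ∣
  in d ≥ k → k ≥ 1 →
  ((+ ((d + 1) C s) -ℤ + (k C s)) ÷ℕ (d ∸ k + 1))
    ℚ.≤ ((+ ((k + d) C s)) ÷ℕ (k + d ∸ 1))
lemma2p31 _ _ (s≤s (s≤s {n = r} _)) _ _ _ _ _ _ _ _ k≤d 1≤k = binomial-average-≤ r k≤d 1≤k
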